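{- Let $\mathbf{C}$ be a category with all pullbacks, with an $\mathcal{M}$-partial map classifier $(T,\eta)$ for a stable system of monos $\mathcal{M}$, and with pushouts along arrows in $\mathcal{M}$. Let $\rho=L\xleftarrow{l}K\xrightarrow{r}R$ be a rule and $m:L\rightarrowtail G$ a match in $\mathcal{M}$. Then $G\Rightarrow^{\mathrm{SqPO}}_{\rho,m}H$ if and only if $G\Rightarrow^{\mathrm{AGREE}}_{(l,r,\eta_K),m}H$.
   Context: A stable system of monos $\mathcal{M}$ is a class of monos containing all isomorphisms, closed under composition, and stable under pullback. An $\mathcal{M}$-partial map classifier is a functor $T:\mathbf{C}\to\mathbf{C}$ with a natural transformation $\eta:\mathrm{Id}\Rightarrow T$ such that for every span $Z\xleftarrow{m}X\xrightarrow{f}Y$ with $m\in\mathcal{M}$ there is a unique arrow $\varphi(m,f):Z\to T(Y)$ making the square $\varphi(m,f)\circ m=\eta_Y\circ f$ a pullback. For $m:X\rightarrowtail Z$ in $\mathcal{M}$ write $\overline{m}=\varphi(m,\mathrm{id}_X)$. (One has $\eta_K\in\mathcal{M}$.) Final pullback complement: $K\xrightarrow{n}D\xrightarrow{a}G$ is a final pullback complement of $K\xrightarrow{l}L\xrightarrow{m}G$ if $a\circ n=m\circ l$ is a pullback and for every pullback $m\circ d=f\circ e$ ($d:K'\to L$, $e:K'\to D'$, $f:D'\to G$) and every $h:K'\to K$ with $l\circ h=d$ there is a unique $g:D'\to D$ with $a\circ g=f$ and $g\circ e=n\circ h$. SqPO rewriting: for a rule (span) $L\xleftarrow{l}K\xrightarrow{r}R$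 and match $m$, $G\Rightarrow^{\mathrm{SqPO}}_{\rho,m}H$ means: $K\xrightarrow{n}D\xrightarrow{a}G$ is a final pullback complement of $K\xrightarrow{l}L\xrightarrow{m}G$, and $R\to H\leftarrow D$ is a pushout of $R\xleftarrow{r}K\xrightarrow{n}D$. AGREE rewriting: for a rule $(K\xrightarrow{l}L,K\xrightarrow{r}R,K\xrightarrow{t}T_K)$ with $t\in\mathcal{M}$ and match $m:L\rightarrowtail G$ in $\mathcal{M}$: let $l'=\varphi(t,l):T_K\to T(L)$; let $G\xleftarrow{g}D\xrightarrow{n'}T_K$ be the pullback of $\overline{m}$ and $l'$; let $n:K\to D$ be the unique arrow with $n'\circ n=t$, $g\circ n=m\circ l$; then $H$ is the pushout object of $D\xleftarrow{n}K\xrightarrow{r}R$. This is written $G\Rightarrow^{\mathrm{AGREE}}_{(l,r,t),m}H$. -}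

module Defs where

open import Level using (Level; _⊔_) renaming (suc to lsuc)
open import Data.Product using (Σ; Σ-syntax; _×_; _,_)
open import Relation.Binary.PropositionalEquality using (_≡_)

record Category (o ℓ : Level) : Set (lsuc (o ⊔ ℓ)) where
  infixr 9 _∘_
  infix 4 _⇒_
  field
    Obj : Set o
    _⇒_ : Obj → Obj → Set ℓ
    id  : ∀ {A} → A ⇒ A
    _∘_ : ∀ {A B C} → B ⇒ C → A ⇒ B → A ⇒ C
    identityˡ : ∀ {A B} {f : A ⇒ B} → id ∘ f ≡ f
    identityʳ : ∀ {A B} {f : A ⇒ B} → f ∘ id ≡ f
    assoc : ∀ {A B C D} {f : A ⇒ B} {g : B ⇒ C} {h : C ⇒ D} →
            (h ∘ g) ∘ f ≡ h ∘ (g ∘ f)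

module _ {o ℓ : Level} (C : Category o ℓ) where
  open Category C

  Mono : ∀ {A B} → A ⇒ B → Set (o ⊔ ℓ)
  Mono {A} f = ∀ {X} (g h : X ⇒ A) → f ∘ g ≡ f ∘ h → g ≡ h

  IsIso : ∀ {A B} → A ⇒ B → Set ℓ
  IsIso {A} {B} f = Σ[ g ∈ B ⇒ A ] (g ∘ f ≡ id × f ∘ g ≡ id)

  IsPullback : ∀ {P A B Z} (f : A ⇒ Z) (g : B ⇒ Z) (p : P ⇒ A) (q : P ⇒ B) →
               Set (o ⊔ ℓ)
  IsPullback {P} {A} {B} f g p q =
    f ∘ p ≡ g ∘ q ×
    (∀ {X} (h : X ⇒ A) (k : X ⇒ B) → f ∘ h ≡ g ∘ k →
      Σ[ u ∈ X ⇒ P ] ((p ∘ u ≡ h × q ∘ u ≡ k) ×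
        (∀ (u' : X ⇒ P) → p ∘ u' ≡ h → q ∘ u' ≡ k → u' ≡ u)))

  IsPushout : ∀ {Z A B Q} (f : Z ⇒ A) (g : Z ⇒ B) (i : A ⇒ Q) (j : B ⇒ Q) →
              Set (o ⊔ ℓ)
  IsPushout {Z} {A} {B} {Q} f g i j =
    i ∘ f ≡ j ∘ g ×
    (∀ {X} (h : A ⇒ X) (k : B ⇒ X) → h ∘ f ≡ k ∘ g →
      Σ[ u ∈ Q ⇒ X ] ((u ∘ i ≡ h × u ∘ j ≡ k) ×
        (∀ (u' : Q ⇒ X) → u' ∘ i ≡ h → u' ∘ j ≡ k → u' ≡ u)))

  HasPullbacks : Set (o ⊔ ℓ)
  HasPullbacks = ∀ {A B Z} (f : A ⇒ Z) (g : B ⇒ Z) →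
    Σ[ P ∈ Obj ] Σ[ p ∈ P ⇒ A ] Σ[ q ∈ P ⇒ B ] IsPullback f g p q

  record StableSystem {ℓm : Level} (M : ∀ {A B} → A ⇒ B → Set ℓm) :
         Set (o ⊔ ℓ ⊔ ℓm) where
    field
      mono   : ∀ {A B} {f : A ⇒ B} → M f → Mono f
      isos   : ∀ {A B} {f : A ⇒ B} → IsIso f → M f
      comp   : ∀ {A B D} {f : A ⇒ B} {g : B ⇒ D} → M f → M g → M (g ∘ f)
      stable : ∀ {P A B Z} {f : A ⇒ Z} {g : B ⇒ Z} {p : P ⇒ A} {q : P ⇒ B} →
               M g → IsPullback f g p q → M p

  HasPushoutsAlong : ∀ {ℓm} (M : ∀ {A B} → A ⇒ B → Set ℓm) → Set (o ⊔ ℓ ⊔ ℓm)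
  HasPushoutsAlong M = ∀ {Z A B} (f : Z ⇒ A) (g : Z ⇒ B) → M f →
    Σ[ Q ∈ Obj ] Σ[ i ∈ A ⇒ Q ] Σ[ j ∈ B ⇒ Q ] IsPushout f g i j

  record Endofunctor : Set (o ⊔ ℓ) where
    field
      F₀ : Obj → Obj
      F₁ : ∀ {A B} → A ⇒ B → F₀ A ⇒ F₀ B
      identity : ∀ {A} → F₁ (id {A}) ≡ id
      homomorphism : ∀ {A B D} {f : A ⇒ B} {g : B ⇒ D} →
                     F₁ (g ∘ f) ≡ F₁ g ∘ F₁ f

  record PartialMapClassifier {ℓm : Level} (M : ∀ {A B} → A ⇒ B → Set ℓm) :
         Set (o ⊔ ℓ ⊔ ℓm) where
    field
      T : Endofunctor
    open Endofunctor T public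
    field
      η : ∀ X → X ⇒ F₀ X
      η-natural : ∀ {X Y} (f : X ⇒ Y) → F₁ f ∘ η X ≡ η Y ∘ f
      φ : ∀ {Z X Y} (m : X ⇒ Z) → M m → (f : X ⇒ Y) → Z ⇒ F₀ Y
      φ-pullback : ∀ {Z X Y} (m : X ⇒ Z) (mM : M m) (f : X ⇒ Y) →
                   IsPullback (φ m mM f) (η Y) m f
      φ-unique : ∀ {Z X Y} (m : X ⇒ Z) (mM : M m) (f : X ⇒ Y) (ψ : Z ⇒ F₀ Y) →
                 IsPullback ψ (η Y) m f → ψ ≡ φ m mM f

    bar : ∀ {X Z} (m : X ⇒ Z) → M m → Z ⇒ F₀ X
    bar m mM = φ m mM id

  IsFPC : ∀ {K L G D} (l : K ⇒ L) (m : L ⇒ G) (n : K ⇒ D) (a : D ⇒ G) →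
          Set (o ⊔ ℓ)
  IsFPC {K} {L} {G} {D} l m n a =
    IsPullback a m n l ×
    (∀ {K' D'} (d : K' ⇒ L) (e : K' ⇒ D') (f : D' ⇒ G) →
       IsPullback m f d e → (h : K' ⇒ K) → l ∘ h ≡ d →
       Σ[ g ∈ D' ⇒ D ] ((a ∘ g ≡ f × g ∘ e ≡ n ∘ h) ×
         (∀ (g' : D' ⇒ D) → a ∘ g' ≡ f → g' ∘ e ≡ n ∘ h → g' ≡ g)))

  SqPO : ∀ {L K R G} (l : K ⇒ L) (r : K ⇒ R) (m : L ⇒ G) (H : Obj) →
         Set (o ⊔ ℓ)
  SqPO {L} {K} {R} {G} l r m H =
    Σ[ D ∈ Obj ] Σ[ n ∈ K ⇒ D ] Σ[ a ∈ D ⇒ G ]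
      (IsFPC l m n a ×
       Σ[ i ∈ R ⇒ H ] Σ[ j ∈ D ⇒ H ] IsPushout r n i j)

  AGREE : ∀ {ℓm} {M : ∀ {A B} → A ⇒ B → Set ℓm} (pmc : PartialMapClassifier M)
          {L K R TK G} (l : K ⇒ L) (r : K ⇒ R) (t : K ⇒ TK) (tM : M t)
          (m : L ⇒ G) (mM : M m) (H : Obj) → Set (o ⊔ ℓ)
  AGREE pmc {L} {K} {R} {TK} {G} l r t tM m mM H =
    Σ[ D ∈ Obj ] Σ[ g ∈ D ⇒ G ] Σ[ n' ∈ D ⇒ TK ]
      (IsPullback (bar m mM) (φ t tM l) g n' ×
       Σ[ n ∈ K ⇒ D ] ((n' ∘ n ≡ t × g ∘ n ≡ m ∘ l) ×
         Σ[ i ∈ R ⇒ H ] Σ[ j ∈ D ⇒ H ] IsPushout r n i j))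
    where open PartialMapClassifier pmc

module Submission where

-- Both rewriting steps end with the same pushout of
-- D ← K → R, so the whole theorem is about the "deletion" square:
--
--   (⋆) Let D be the pullback of  m̄ : G → T L  and  l' = φ(η_K, l) : T K → T L
--       with legs g : D → G and n' : D → T K, and let n : K → D satisfy
--       n' ∘ n = η_K and g ∘ n = m ∘ l.  Then  K -n→ D -g→ G  is a final
--       pullback complement of  K -l→ L -m→ G.
--
-- (⋆) immediately gives AGREE ⇒ SqPO.  For SqPO ⇒ AGREE we build the
-- pullback D₀ of m̄ and l'; by (⋆) it is a final pullback complement, and
-- final pullback complements are unique up to isomorphism, so the given
-- complement D inherits the pullback property of D₀.

open import Defs
open import Level using (Level)
open import Function.Bundles using (_⇔_; mk⇔)
open import Data.Product using (Σ; Σ-syntax; _×_; _,_; proj₁; proj₂)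
open import Relation.Binary.PropositionalEquality
  using (_≡_; refl; sym; trans; cong; subst; module ≡-Reasoning)

module PullbackFacts {o ℓ : Level} (C : Category o ℓ) where
  open Category C
  open ≡-Reasoning

  pullˡ : ∀ {A B D E} {a : D ⇒ E} {b : B ⇒ D} {c : B ⇒ E} {f : A ⇒ B} →
          a ∘ b ≡ c → a ∘ (b ∘ f) ≡ c ∘ f
  pullˡ eq = trans (sym assoc) (cong (_∘ _) eq)

  extend : ∀ {A B D₁ D₂ E} {a : D₁ ⇒ E} {b : B ⇒ D₁} {c : D₂ ⇒ E} {d : B ⇒ D₂}
           {f : A ⇒ B} → a ∘ b ≡ c ∘ d → a ∘ (b ∘ f) ≡ c ∘ (d ∘ f)
  extend eq = trans (pullˡ eq) assoc

  module Pullback {P A B Z} {f : A ⇒ Z} {g : B ⇒ Z} {p : P ⇒ A} {q : P ⇒ B}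
                  (pb : IsPullback C f g p q) where
    comm : f ∘ p ≡ g ∘ q
    comm = proj₁ pb

    med : ∀ {X} (h : X ⇒ A) (k : X ⇒ B) → f ∘ h ≡ g ∘ k → X ⇒ P
    med h k e = proj₁ (proj₂ pb h k e)

    medˡ : ∀ {X} (h : X ⇒ A) (k : X ⇒ B) (e : f ∘ h ≡ g ∘ k) → p ∘ med h k e ≡ h
    medˡ h k e = proj₁ (proj₁ (proj₂ (proj₂ pb h k e)))

    medʳ : ∀ {X} (h : X ⇒ A) (k : X ⇒ B) (e : f ∘ h ≡ g ∘ k) → q ∘ med h k e ≡ k
    medʳ h k e = proj₂ (proj₁ (proj₂ (proj₂ pb h k e)))

    uniq : ∀ {X} (h : X ⇒ A) (k : X ⇒ B) (e : f ∘ h ≡ g ∘ k) (u : X ⇒ P) →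
           p ∘ u ≡ h → q ∘ u ≡ k → u ≡ med h k e
    uniq h k e = proj₂ (proj₂ (proj₂ pb h k e))

    jointly-monic : ∀ {X} (u v : X ⇒ P) → p ∘ u ≡ p ∘ v → q ∘ u ≡ q ∘ v → u ≡ v
    jointly-monic u v pu qu = trans (uniq _ _ cv u pu qu) (sym (uniq _ _ cv v refl refl))
      where
      cv : f ∘ (p ∘ v) ≡ g ∘ (q ∘ v)
      cv = extend comm

  pullback-sym : ∀ {P A B Z} {f : A ⇒ Z} {g : B ⇒ Z} {p : P ⇒ A} {q : P ⇒ B} →
                 IsPullback C f g p q → IsPullback C g f q p
  pullback-sym pb = sym comm , λ h k e →
    med k h (sym e) , (medʳ k h (sym e) , medˡ k h (sym e)) ,
    λ u e₁ e₂ → uniq k h (sym e) u e₂ e₁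
    where open Pullback pb

  pullback-paste : ∀ {P A B Q Z R} {f₁ : A ⇒ B} {g₁ : Q ⇒ B} {p : P ⇒ A} {q : P ⇒ Q}
                   {f₂ : B ⇒ Z} {g₂ : R ⇒ Z} {r : Q ⇒ R} →
                   IsPullback C f₁ g₁ p q → IsPullback C f₂ g₂ g₁ r →
                   IsPullback C (f₂ ∘ f₁) g₂ p (r ∘ q)
  pullback-paste {f₁ = f₁} {g₁} {p} {q} {f₂} {g₂} {r} inner outer =
    commutes , universal
    where
    module I = Pullback inner
    module O = Pullback outer
    commutes : (f₂ ∘ f₁) ∘ p ≡ g₂ ∘ (r ∘ q)
    commutes = begin
      (f₂ ∘ f₁) ∘ p ≡⟨ assoc ⟩
      f₂ ∘ (f₁ ∘ p) ≡⟨ cong (f₂ ∘_) I.comm ⟩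
      f₂ ∘ (g₁ ∘ q) ≡⟨ extend O.comm ⟩
      g₂ ∘ (r ∘ q)  ∎
    universal : ∀ {X} (x : X ⇒ _) (y : X ⇒ _) → (f₂ ∘ f₁) ∘ x ≡ g₂ ∘ y →
                Σ[ u ∈ X ⇒ _ ] ((p ∘ u ≡ x × (r ∘ q) ∘ u ≡ y) ×
                  (∀ (u' : X ⇒ _) → p ∘ u' ≡ x → (r ∘ q) ∘ u' ≡ y → u' ≡ u))
    universal x y e = u , (I.medˡ x w inner-eq , rqu) , unique
      where
      outer-eq : f₂ ∘ (f₁ ∘ x) ≡ g₂ ∘ y
      outer-eq = trans (sym assoc) e
      w = O.med (f₁ ∘ x) y outer-eq
      inner-eq : f₁ ∘ x ≡ g₁ ∘ w
      inner-eq = sym (O.medˡ (f₁ ∘ x) y outer-eq)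
      u = I.med x w inner-eq
      rqu : (r ∘ q) ∘ u ≡ y
      rqu = trans assoc (trans (cong (r ∘_) (I.medʳ x w inner-eq)) (O.medʳ (f₁ ∘ x) y outer-eq))
      unique : ∀ u' → p ∘ u' ≡ x → (r ∘ q) ∘ u' ≡ y → u' ≡ u
      unique u' pu' rqu' = I.uniq x w inner-eq u' pu'
        (O.uniq (f₁ ∘ x) y outer-eq (q ∘ u')
          (trans (sym (extend I.comm)) (cong (f₁ ∘_) pu'))
          (trans (sym assoc) rqu'))

  record Iso (A B : Obj) : Set ℓ where
    field
      to      : A ⇒ B
      from    : B ⇒ A
      from∘to : from ∘ to ≡ id
      to∘from : to ∘ from ≡ id
  open Iso

  pullback-transport : ∀ {P' P A B Z} {f : A ⇒ Z} {g : B ⇒ Z} {p : P ⇒ A} {q : P ⇒ B} →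
                       IsPullback C f g p q → (i : Iso P' P) →
                       IsPullback C f g (p ∘ to i) (q ∘ to i)
  pullback-transport {P = P} {p = p} {q} pb i = extend comm , λ h k e →
    from i ∘ med h k e ,
    (cancel p (medˡ h k e) , cancel q (medʳ h k e)) ,
    λ z pz qz → begin
      z                     ≡⟨ sym identityˡ ⟩
      id ∘ z                ≡⟨ cong (_∘ z) (sym (from∘to i)) ⟩
      (from i ∘ to i) ∘ z   ≡⟨ assoc ⟩
      from i ∘ (to i ∘ z)   ≡⟨ cong (from i ∘_) (uniq h k e (to i ∘ z)
                                 (trans (sym assoc) pz) (trans (sym assoc) qz)) ⟩
      from i ∘ med h k e    ∎
    where
    open Pullback pb
    cancel : ∀ {X Y} {w : X ⇒ P} (s : P ⇒ Y) {v : X ⇒ Y} → s ∘ w ≡ v →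
             (s ∘ to i) ∘ (from i ∘ w) ≡ v
    cancel {w = w} s sw = begin
      (s ∘ to i) ∘ (from i ∘ w) ≡⟨ trans assoc (cong (s ∘_) (pullˡ (to∘from i))) ⟩
      s ∘ (id ∘ w)              ≡⟨ cong (s ∘_) identityˡ ⟩
      s ∘ w                     ≡⟨ sw ⟩
      _                         ∎

  module _ {K L G D} {l : K ⇒ L} {m : L ⇒ G} {n : K ⇒ D} {a : D ⇒ G} where

    fpc-compare : IsFPC C l m n a → ∀ {D₀} {n₀ : K ⇒ D₀} {a₀ : D₀ ⇒ G} →
                  IsPullback C a₀ m n₀ l →
                  Σ[ u ∈ D₀ ⇒ D ] ((a ∘ u ≡ a₀ × u ∘ n₀ ≡ n) ×
                    (∀ (u' : D₀ ⇒ D) → a ∘ u' ≡ a₀ → u' ∘ n₀ ≡ n → u' ≡ u))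
    fpc-compare (_ , final) {n₀ = n₀} pb₀ with final l n₀ _ (pullback-sym pb₀) id identityʳ
    ... | u , (au , un₀) , unique =
      u , (au , trans un₀ identityʳ) ,
      λ u' au' u'n₀ → unique u' au' (trans u'n₀ (sym identityʳ))

    fpc-endo-id : IsFPC C l m n a → (w : D ⇒ D) → a ∘ w ≡ a → w ∘ n ≡ n → w ≡ id
    fpc-endo-id fpc w aw wn with fpc-compare fpc (proj₁ fpc)
    ... | _ , _ , unique = trans (unique w aw wn) (sym (unique id identityʳ identityˡ))

  fpc-unique : ∀ {K L G D D₀} {l : K ⇒ L} {m : L ⇒ G} {n : K ⇒ D} {a : D ⇒ G}
               {n₀ : K ⇒ D₀} {a₀ : D₀ ⇒ G} →
               IsFPC C l m n a → IsFPC C l m n₀ a₀ →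
               Σ[ i ∈ Iso D D₀ ] (a₀ ∘ to i ≡ a × to i ∘ n ≡ n₀)
  fpc-unique fpc fpc₀
    with fpc-compare fpc₀ (proj₁ fpc) | fpc-compare fpc (proj₁ fpc₀)
  ... | v , (a₀v , vn) , _ | u , (au , un₀) , _ =
    record { to = v ; from = u
           ; from∘to = fpc-endo-id fpc (u ∘ v) (trans (pullˡ au) a₀v)
                                        (trans assoc (trans (cong (u ∘_) vn) un₀))
           ; to∘from = fpc-endo-id fpc₀ (v ∘ u) (trans (pullˡ a₀v) au)
                                        (trans assoc (trans (cong (v ∘_) un₀) vn)) } ,
    a₀v , vn

module Agreement {o ℓ ℓm : Level} (C : Category o ℓ)
  (M : ∀ {A B : Category.Obj C} → Category._⇒_ C A B → Set ℓm)
  (SM : StableSystem C M) (pmc : PartialMapClassifier C M) where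
  open Category C
  open StableSystem SM
  open PartialMapClassifier pmc
  open PullbackFacts C
  open ≡-Reasoning

  module Rule {L K G : Obj} (l : K ⇒ L) (m : L ⇒ G) (mM : M m) (ηK∈M : M (η K)) where

    l' : F₀ K ⇒ F₀ L
    l' = φ (η K) ηK∈M l

    m̄ : G ⇒ F₀ L
    m̄ = bar m mM

    l'-classifies : IsPullback C l' (η L) (η K) l
    l'-classifies = φ-pullback (η K) ηK∈M l

    m̄-classifies : IsPullback C m̄ (η L) m id
    m̄-classifies = φ-pullback m mM id

    m̄∘m : m̄ ∘ m ≡ η L
    m̄∘m = trans (Pullback.comm m̄-classifies) identityʳ

    m̄-factor : ∀ {X} (x : X ⇒ G) (y : X ⇒ L) → m̄ ∘ x ≡ η L ∘ y → x ≡ m ∘ y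
    m̄-factor x y e = trans (sym (medˡ x y e)) (cong (m ∘_) (trans (sym identityˡ) (medʳ x y e)))
      where open Pullback m̄-classifies

    m̄∘m∘l : m̄ ∘ (m ∘ l) ≡ l' ∘ η K
    m̄∘m∘l = trans (pullˡ m̄∘m) (sym (Pullback.comm l'-classifies))

    module AgreeSquare {D} (g : D ⇒ G) (n' : D ⇒ F₀ K) (pb : IsPullback C m̄ l' g n')
                       (n : K ⇒ D) (n'n : n' ∘ n ≡ η K) (gn : g ∘ n ≡ m ∘ l) where
      module P = Pullback pb
      module Pl' = Pullback l'-classifies

      square-is-pullback : IsPullback C g m n l
      square-is-pullback = gn , λ h k gh≡mk →
        let q : l' ∘ (n' ∘ h) ≡ η L ∘ k
            q = begin
              l' ∘ (n' ∘ h) ≡⟨ sym (extend P.comm) ⟩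
              m̄ ∘ (g ∘ h)   ≡⟨ cong (m̄ ∘_) gh≡mk ⟩
              m̄ ∘ (m ∘ k)   ≡⟨ pullˡ m̄∘m ⟩
              η L ∘ k        ∎
            w = Pl'.med (n' ∘ h) k q
            nw≡h : n ∘ w ≡ h
            nw≡h = P.jointly-monic (n ∘ w) h
              (trans (extend gn) (trans (cong (m ∘_) (Pl'.medʳ (n' ∘ h) k q)) (sym gh≡mk)))
              (trans (pullˡ n'n) (Pl'.medˡ (n' ∘ h) k q))
        in w , (nw≡h , Pl'.medʳ (n' ∘ h) k q) , λ w' nw' lw' →
          Pl'.uniq (n' ∘ h) k q w' (trans (sym (pullˡ n'n)) (cong (n' ∘_) nw')) lw'

      factor-through-n : ∀ {X} (x : X ⇒ D) (y : X ⇒ K) → n' ∘ x ≡ η K ∘ y → x ≡ n ∘ y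
      factor-through-n x y e = P.jointly-monic x (n ∘ y)
        (trans gx≡mly (sym (extend gn)))
        (trans e (sym (pullˡ n'n)))
        where
        gx≡mly : g ∘ x ≡ m ∘ (l ∘ y)
        gx≡mly = m̄-factor (g ∘ x) (l ∘ y) (begin
          m̄ ∘ (g ∘ x)     ≡⟨ extend P.comm ⟩
          l' ∘ (n' ∘ x)   ≡⟨ cong (l' ∘_) e ⟩
          l' ∘ (η K ∘ y)  ≡⟨ extend Pl'.comm ⟩
          η L ∘ (l ∘ y)   ∎)

      module Competitor {K' D'} (d : K' ⇒ L) (e : K' ⇒ D') (f : D' ⇒ G)
                        (pbE : IsPullback C m f d e) (h : K' ⇒ K) (lh : l ∘ h ≡ d) where
        module E = Pullback pbE

        e∈M : M e
        e∈M = stable mM (pullback-sym pbE)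

        ψ : D' ⇒ F₀ K
        ψ = φ e e∈M h

        -- Both m̄ ∘ f and l' ∘ ψ classify the partial map (e, d).
        m̄f≡l'ψ : m̄ ∘ f ≡ l' ∘ ψ
        m̄f≡l'ψ = trans (φ-unique e e∈M d _ via-m̄) (sym (φ-unique e e∈M d _ via-l'))
          where
          via-m̄ : IsPullback C (m̄ ∘ f) (η L) e d
          via-m̄ = subst (IsPullback C (m̄ ∘ f) (η L) e) identityˡ
                    (pullback-paste (pullback-sym pbE) m̄-classifies)
          via-l' : IsPullback C (l' ∘ ψ) (η L) e d
          via-l' = subst (IsPullback C (l' ∘ ψ) (η L) e) lh
                     (pullback-paste (φ-pullback e e∈M h) l'-classifies)

        classifying-square : (u : D' ⇒ D) → g ∘ u ≡ f → u ∘ e ≡ n ∘ h →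
                             IsPullback C (n' ∘ u) (η K) e h
        classifying-square u gu ue = commutes , λ x y q →
          let ux≡ny = factor-through-n (u ∘ x) y (trans (sym assoc) q)
              mly≡fx : m ∘ (l ∘ y) ≡ f ∘ x
              mly≡fx = begin
                m ∘ (l ∘ y)  ≡⟨ sym (extend gn) ⟩
                g ∘ (n ∘ y)  ≡⟨ cong (g ∘_) (sym ux≡ny) ⟩
                g ∘ (u ∘ x)  ≡⟨ pullˡ gu ⟩
                f ∘ x        ∎
              z = E.med (l ∘ y) x mly≡fx
              ez = E.medʳ (l ∘ y) x mly≡fx
              hz≡y : h ∘ z ≡ y
              hz≡y = mono ηK∈M (h ∘ z) y (begin
                η K ∘ (h ∘ z)         ≡⟨ sym (trans (pullˡ commutes) assoc) ⟩
                (n' ∘ u) ∘ (e ∘ z)    ≡⟨ cong ((n' ∘ u) ∘_) ez ⟩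
                (n' ∘ u) ∘ x          ≡⟨ q ⟩
                η K ∘ y               ∎)
          in z , (ez , hz≡y) , λ z' ez' hz' →
            E.uniq (l ∘ y) x mly≡fx z' (trans (cong (_∘ z') (sym lh)) (trans assoc (cong (l ∘_) hz'))) ez'
          where
          commutes : (n' ∘ u) ∘ e ≡ η K ∘ h
          commutes = trans assoc (trans (cong (n' ∘_) ue) (pullˡ n'n))

        mediate : Σ[ u ∈ D' ⇒ D ] ((g ∘ u ≡ f × u ∘ e ≡ n ∘ h) ×
                    (∀ (u' : D' ⇒ D) → g ∘ u' ≡ f → u' ∘ e ≡ n ∘ h → u' ≡ u))
        mediate = u , (gu , ue) , λ u' gu' u'e →
          P.uniq f ψ m̄f≡l'ψ u' gu'
            (φ-unique e e∈M h (n' ∘ u') (classifying-square u' gu' u'e))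
          where
          u : D' ⇒ D
          u = P.med f ψ m̄f≡l'ψ
          gu : g ∘ u ≡ f
          gu = P.medˡ f ψ m̄f≡l'ψ
          ue : u ∘ e ≡ n ∘ h
          ue = P.jointly-monic (u ∘ e) (n ∘ h)
            (begin
              g ∘ (u ∘ e)  ≡⟨ pullˡ gu ⟩
              f ∘ e        ≡⟨ sym E.comm ⟩
              m ∘ d        ≡⟨ cong (m ∘_) (sym lh) ⟩
              m ∘ (l ∘ h)  ≡⟨ sym (extend gn) ⟩
              g ∘ (n ∘ h)  ∎)
            (begin
              n' ∘ (u ∘ e) ≡⟨ pullˡ (P.medʳ f ψ m̄f≡l'ψ) ⟩
              ψ ∘ e        ≡⟨ Pullback.comm (φ-pullback e e∈M h) ⟩
              η K ∘ h      ≡⟨ sym (pullˡ n'n) ⟩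
              n' ∘ (n ∘ h) ∎)

      is-fpc : IsFPC C l m n g
      is-fpc = square-is-pullback , Competitor.mediate

    -- A pullback of m̄ and l' receives a comparison arrow from K, since the
    -- outer square of the rewriting diagram commutes.
    comparison : ∀ {D₀} {g₀ : D₀ ⇒ G} {n'₀ : D₀ ⇒ F₀ K} → IsPullback C m̄ l' g₀ n'₀ →
                 Σ[ n₀ ∈ K ⇒ D₀ ] (n'₀ ∘ n₀ ≡ η K × g₀ ∘ n₀ ≡ m ∘ l)
    comparison pb₀ = med (m ∘ l) (η K) m̄∘m∘l , medʳ (m ∘ l) (η K) m̄∘m∘l , medˡ (m ∘ l) (η K) m̄∘m∘l
      where open Pullback pb₀

    -- Conversely, every final pullback complement of (l, m) is an AGREE
    -- deletion square: it is isomorphic to a chosen pullback of m̄ and l',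
    -- which is a final pullback complement by (⋆).
    fpc-is-agree-square : HasPullbacks C → ∀ {D} {n : K ⇒ D} {a : D ⇒ G} → IsFPC C l m n a →
                          Σ[ n' ∈ D ⇒ F₀ K ] (IsPullback C m̄ l' a n' × n' ∘ n ≡ η K)
    fpc-is-agree-square pullbacks {n = n} fpc =
      let (_ , g₀ , n'₀ , pb₀) = pullbacks m̄ l'
          (n₀ , n'₀n₀ , g₀n₀) = comparison pb₀
          (i , g₀v≡a , vn≡n₀) = fpc-unique fpc (AgreeSquare.is-fpc g₀ n'₀ pb₀ n₀ n'₀n₀ g₀n₀)
          v = Iso.to i
      in n'₀ ∘ v ,
         subst (λ a' → IsPullback C m̄ l' a' (n'₀ ∘ v)) g₀v≡a (pullback-transport pb₀ i) ,
         (begin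
           (n'₀ ∘ v) ∘ n  ≡⟨ assoc ⟩
           n'₀ ∘ (v ∘ n)  ≡⟨ cong (n'₀ ∘_) vn≡n₀ ⟩
           n'₀ ∘ n₀       ≡⟨ n'₀n₀ ⟩
           η K            ∎)

theorem2 : ∀ {o ℓ ℓm : Level} (C : Category o ℓ)
    (M : ∀ {A B : Category.Obj C} → Category._⇒_ C A B → Set ℓm)
    (SM : StableSystem C M) (pullbacks : HasPullbacks C)
    (pmc : PartialMapClassifier C M) (pushouts : HasPushoutsAlong C M)
    {L K R G : Category.Obj C}
    (l : Category._⇒_ C K L) (r : Category._⇒_ C K R)
    (m : Category._⇒_ C L G) (mM : M m)
    (ηK∈M : M (PartialMapClassifier.η pmc K))
    (H : Category.Obj C) →
    SqPO C l r m H ⇔ AGREE C pmc l r (PartialMapClassifier.η pmc K) ηK∈M m mM H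
theorem2 C M SM pullbacks pmc _ l r m mM ηK∈M H = mk⇔ sqpo→agree agree→sqpo
  where
  open PartialMapClassifier pmc using (η)
  open Agreement.Rule C M SM pmc l m mM ηK∈M

  sqpo→agree : SqPO C l r m H → AGREE C pmc l r (η _) ηK∈M m mM H
  sqpo→agree (D , n , a , fpc , pushout) =
    let (n' , pb , n'n) = fpc-is-agree-square pullbacks fpc
    in D , a , n' , pb , n , (n'n , proj₁ (proj₁ fpc)) , pushout

  agree→sqpo : AGREE C pmc l r (η _) ηK∈M m mM H → SqPO C l r m H
  agree→sqpo (D , g , n' , pb , n , (n'n , gn) , pushout) =
    D , n , g , AgreeSquare.is-fpc g n' pb n n'n gn , pushout
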